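{- Let $\mathscr C$ be a hereditary pattern-free graph class and let $M\in\overline{\mathscr C}$. Then $M$ is pattern-free.
   Context: $\overline{\mathscr C}$ (the elementary closure) is the class of all models (possibly infinite graphs) of the theory of $\mathscr C$, i.e. of the set of first-order sentences true in every graph of $\mathscr C$. Hereditary: closed under induced subgraphs. For a structure $\widehat G$ and formula $\varphi(x,y)$, $\varphi(\widehat G)$ is the graph on $V(\widehat G)$ with edges $uv$, $u\ne v$, with $\widehat G\models\varphi(u,v)\lor\varphi(v,u)$. The $r$-subdivision replaces each edge by a path of length $r+1$. A class $\mathscr D$ is pattern-free if for every $r\ge1$, every class $\widehat{\mathscr D}$ of expansions of members of $\mathscr D$ by unary predicates (fixed signature) and every quantifier-free $\varphi(x,y)$ there is $n$ such that for no $\widehat G\in\widehat{\mathscr D}$ does $\varphi(\widehat G)$ contain the $r$-subdivision of $K_n$ as an induced subgraph; a graph $M$ is pattern-free if $\{M\}$ is. -}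

module Defs where

open import Data.Nat using (ℕ; zero; suc; _≤_)
open import Data.Fin using (Fin; toℕ; _<_) renaming (zero to fz; suc to fs)
open import Data.Product using (Σ; _×_; _,_)
open import Data.Sum using (_⊎_)
open import Data.Empty using (⊥)
open import Data.Unit using (⊤)
open import Relation.Nullary using (¬_; Dec)
open import Relation.Binary.PropositionalEquality using (_≡_)
open import Function.Bundles using (_↔_; _⇔_)

record Graph : Set₁ where
  field
    V      : Set
    E      : V → V → Set
    sym    : ∀ u v → E u v → E v u
    irrefl : ∀ u → ¬ E u u
open Graph public

-- A graph is finite: its vertex set is in bijection with some Fin n,
-- and (as for any finite graph) adjacency is decidable.
FiniteGraph : Graph → Set
FiniteGraph G = Σ ℕ (λ n → (V G ↔ Fin n)) × (∀ u v → Dec (E G u v))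

InducedSub : Graph → Graph → Set
InducedSub H G =
  Σ (V H → V G) λ f →
    (∀ u v → f u ≡ f v → u ≡ v) × (∀ u v → E H u v ⇔ E G (f u) (f v))

GraphClass : Set₂
GraphClass = Graph → Set₁

Hereditary : GraphClass → Set₁
Hereditary C = ∀ G H → C G → FiniteGraph H → InducedSub H G → C H

data Fm : ℕ → Set where
  ff   : ∀ {n} → Fm n
  adj  : ∀ {n} → Fin n → Fin n → Fm n
  eq   : ∀ {n} → Fin n → Fin n → Fm n
  _⇒_  : ∀ {n} → Fm n → Fm n → Fm n
  _∧_  : ∀ {n} → Fm n → Fm n → Fm n
  _∨_  : ∀ {n} → Fm n → Fm n → Fm n
  all  : ∀ {n} → Fm (suc n) → Fm n
  ex   : ∀ {n} → Fm (suc n) → Fm n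

extend : {A : Set} {n : ℕ} → A → (Fin n → A) → Fin (suc n) → A
extend a ρ fz     = a
extend a ρ (fs i) = ρ i

Sat : (G : Graph) {n : ℕ} → (Fin n → V G) → Fm n → Set
Sat G ρ ff        = ⊥
Sat G ρ (adj i j) = E G (ρ i) (ρ j)
Sat G ρ (eq i j)  = ρ i ≡ ρ j
Sat G ρ (φ ⇒ ψ)   = Sat G ρ φ → Sat G ρ ψ
Sat G ρ (φ ∧ ψ)   = Sat G ρ φ × Sat G ρ ψ
Sat G ρ (φ ∨ ψ)   = Sat G ρ φ ⊎ Sat G ρ ψ
Sat G ρ (all φ)   = ∀ a → Sat G (extend a ρ) φ
Sat G ρ (ex φ)    = Σ (V G) λ a → Sat G (extend a ρ) φ

Sentence : Set
Sentence = Fm 0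

noVars : {A : Set} → Fin 0 → A
noVars ()

_⊨_ : Graph → Sentence → Set
G ⊨ φ = Sat G noVars φ

Th : GraphClass → Sentence → Set₁
Th C φ = ∀ G → C G → G ⊨ φ

InElemClosure : GraphClass → Graph → Set₁
InElemClosure C M = ∀ φ → Th C φ → M ⊨ φ

record Expansion (k : ℕ) : Set₁ where
  field
    graph : Graph
    P     : Fin k → V graph → Set
open Expansion public

data QF (k : ℕ) : Set where
  qff   : QF k
  qadj  : Fin 2 → Fin 2 → QF k
  qeq   : Fin 2 → Fin 2 → QF k
  qpred : Fin k → Fin 2 → QF k
  _q⇒_  : QF k → QF k → QF k
  _q∧_  : QF k → QF k → QF k
  _q∨_  : QF k → QF k → QF k

pair : {A : Set} → A → A → Fin 2 → A
pair x y fz     = x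
pair x y (fs _) = y

QSatρ : ∀ {k} (e : Expansion k) → (Fin 2 → V (graph e)) → QF k → Set
QSatρ e ρ qff         = ⊥
QSatρ e ρ (qadj i j)  = E (graph e) (ρ i) (ρ j)
QSatρ e ρ (qeq i j)   = ρ i ≡ ρ j
QSatρ e ρ (qpred p i) = P e p (ρ i)
QSatρ e ρ (φ q⇒ ψ)    = QSatρ e ρ φ → QSatρ e ρ ψ
QSatρ e ρ (φ q∧ ψ)    = QSatρ e ρ φ × QSatρ e ρ ψ
QSatρ e ρ (φ q∨ ψ)    = QSatρ e ρ φ ⊎ QSatρ e ρ ψ

QSat : ∀ {k} (e : Expansion k) → V (graph e) → V (graph e) → QF k → Set
QSat e u v φ = QSatρ e (pair u v) φ

φAdj : ∀ {k} (e : Expansion k) → QF k → V (graph e) → V (graph e) → Set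
φAdj e φ u v = (¬ u ≡ v) × (QSat e u v φ ⊎ QSat e v u φ)

-- The r-subdivision of K_n: branch vertices Fin n; for each pair i < j
-- internal vertices (i,j,0),…,(i,j,r-1) forming the path
-- i — (i,j,0) — … — (i,j,r-1) — j of length r+1.

data SubV (r n : ℕ) : Set where
  branch : Fin n → SubV r n
  inner  : (i j : Fin n) → i < j → Fin r → SubV r n

data SubE {r n : ℕ} : SubV r n → SubV r n → Set where
  start : ∀ {i j p k} → toℕ k ≡ 0 →
          SubE (branch i) (inner i j p k)
  step  : ∀ {i j p k k'} → toℕ k' ≡ suc (toℕ k) →
          SubE (inner i j p k) (inner i j p k')
  end   : ∀ {i j p k} → suc (toℕ k) ≡ r →
          SubE (inner i j p k) (branch j)

SubAdj : ∀ {r n} → SubV r n → SubV r n → Set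
SubAdj a b = SubE a b ⊎ SubE b a

ContainsSub : ∀ {k} (r n : ℕ) (e : Expansion k) → QF k → Set
ContainsSub r n e φ =
  Σ (SubV r n → V (graph e)) λ f →
    (∀ a b → f a ≡ f b → a ≡ b) ×
    (∀ a b → SubAdj a b ⇔ φAdj e φ (f a) (f b))

PatternFree : GraphClass → Set₂
PatternFree D =
  ∀ (r : ℕ) → 1 ≤ r → ∀ (k : ℕ) →
  (Dhat : Expansion k → Set₁) → (∀ e → Dhat e → D (graph e)) →
  (φ : QF k) →
  Σ ℕ λ n → ∀ e → Dhat e → ¬ ContainsSub r n e φ

Singleton : Graph → GraphClass
Singleton M G = G ≡ M

{-# OPTIONS --safe #-}
-- Let n be the bound that pattern-freeness of C gives for r and φ, and suppose φ(M̂) contains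
-- the r-subdivision of Kₙ via f, for an expansion M̂ of M. Its vertex set S is finite, so the
-- induced subgraph H of M on f(S) is described by its existential atomic diagram, a sentence
-- true in M. As M satisfies Th(C), not every graph of C refutes it; a graph of C satisfying it
-- contains H as an induced subgraph, so H ∈ C by heredity. Quantifier-free formulas are
-- preserved under embeddings, so φ still draws the subdivision on H expanded by the predicates
-- of M̂, contradicting the choice of n. Constructively this yields ¬¬(H ∈ C), and adjacency on
-- H is only ¬¬-decidable; both suffice because the conclusion is a negation.
module Submission where

open import Data.Nat using (ℕ; zero; suc; _+_; _*_)
open import Data.Fin using (Fin) renaming (zero to fz; suc to fs)
open import Data.Fin.Properties
  using (+↔⊎; *↔×; <-irrelevant; inj⇒≟; sequence) renaming (_≟_ to _≟ᶠ_; _<?_ to _<ᶠ?_)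
open import Data.List using (List; map; lookup; length; deduplicate; allFin)
open import Data.List.Membership.Propositional using (_∈_)
open import Data.List.Membership.Propositional.Properties using (∈-map⁺; ∈-allFin; ∈-deduplicate⁺; ∈-lookup)
open import Data.List.Relation.Unary.All as All using ()
open import Data.List.Relation.Unary.AllPairs using (_∷_)
open import Data.List.Relation.Unary.Any using (index)
open import Data.List.Relation.Unary.Any.Properties using (lookup-index)
open import Data.List.Relation.Unary.Unique.Propositional using (Unique)
open import Data.List.Relation.Unary.Unique.DecPropositional.Properties using (deduplicate-!)
open import Data.Product using (Σ; _×_; _,_; proj₁; proj₂)
import Data.Product as Product
open import Data.Product.Function.NonDependent.Propositional using (_×-↔_; _×-⇔_)
open import Data.Sum using (_⊎_; inj₁; inj₂)
import Data.Sum as Sum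
open import Data.Sum.Function.Propositional using (_⊎-↔_; _⊎-⇔_)
open import Data.Empty using (⊥-elim)
open import Effect.Monad using (RawMonad)
open import Function using (_∘_; id; const)
open import Function.Bundles using (_↔_; _⇔_; mk⇔; mk↣; mk↔ₛ′; Inverse; Injection; Equivalence)
open import Function.Construct.Composition using (_↔-∘_; _⇔-∘_)
open import Function.Construct.Identity using (↔-id; ⇔-id)
open import Function.Construct.Symmetry using (↔-sym; ⇔-sym)
open import Function.Definitions using (Injective)
open import Function.Properties.Inverse using (↔⇒↣)
open import Function.Related.TypeIsomorphisms using (→-cong-⇔; ¬-cong-⇔)
open import Relation.Binary.Definitions using (DecidableEquality)
open import Relation.Binary.PropositionalEquality as ≡ using (_≡_; _≗_; refl; cong; subst; subst₂)
open import Relation.Nullary using (¬_; Dec; yes; no)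
open import Relation.Nullary.Decidable using (¬¬-excluded-middle)
import Relation.Nullary.Decidable as Dec
open import Relation.Nullary.Negation using (¬¬-Monad; ¬¬-map)

open import Defs

open Equivalence using (to; from)

lookup-injective : {A : Set} {xs : List A} → Unique xs → Injective _≡_ _≡_ (lookup xs)
lookup-injective (_ ∷ _) {fz} {fz} _ = refl
lookup-injective (x∉ ∷ _) {fz} {fs j} p = ⊥-elim (All.lookup x∉ (∈-lookup j) p)
lookup-injective (x∉ ∷ _) {fs i} {fz} p = ⊥-elim (All.lookup x∉ (∈-lookup i) (≡.sym p))
lookup-injective (_ ∷ u) {fs i} {fs j} p = cong fs (lookup-injective u p)

retract-of-Fin⇒finite : {A : Set} {m : ℕ} (code : A → Fin m) (decode : Fin m → A) →
                        (∀ a → decode (code a) ≡ a) → Σ ℕ λ N → A ↔ Fin N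
retract-of-Fin⇒finite {A} {m} code decode decode-code =
  length enum , mk↔ₛ′ position (lookup enum) position-lookup lookup-position
  where
  code-injective : Injective _≡_ _≡_ code
  code-injective {a} {b} p = ≡.trans (≡.sym (decode-code a)) (≡.trans (cong decode p) (decode-code b))

  _≟_ : DecidableEquality A
  _≟_ = inj⇒≟ (mk↣ code-injective)

  enum : List A
  enum = deduplicate _≟_ (map decode (allFin m))

  ∈-enum : ∀ a → a ∈ enum
  ∈-enum a = ∈-deduplicate⁺ _≟_
    (subst (_∈ map decode (allFin m)) (decode-code a) (∈-map⁺ decode (∈-allFin (code a))))

  position : A → Fin (length enum)
  position a = index (∈-enum a)

  lookup-position : ∀ a → lookup enum (position a) ≡ a
  lookup-position a = ≡.sym (lookup-index (∈-enum a))

  position-lookup : ∀ i → position (lookup enum i) ≡ i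
  position-lookup i =
    lookup-injective (deduplicate-! _≟_ (map decode (allFin m))) (lookup-position (lookup enum i))

SubCode : ℕ → ℕ → Set
SubCode r n = Fin n ⊎ (Fin n × Fin n × Fin r)

SubCode↔Fin : ∀ r n → SubCode r n ↔ Fin (n + n * (n * r))
SubCode↔Fin r n =
  ↔-sym ((↔-id (Fin n) ⊎-↔ (↔-id (Fin n) ×-↔ *↔×)) ↔-∘ ((↔-id (Fin n) ⊎-↔ *↔×) ↔-∘ +↔⊎))

encode : ∀ {r n} → SubV r n → SubCode r n
encode (branch i)      = inj₁ i
encode (inner i j _ k) = inj₂ (i , j , k)

-- Codes with i ≮ j name no vertex; they are sent to an arbitrary one.
decode : ∀ {r n} → SubCode r n → SubV r n
decode (inj₁ i) = branch i
decode (inj₂ (i , j , k)) with i <ᶠ? j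
... | yes i<j = inner i j i<j k
... | no _    = branch i

decode-encode : ∀ {r n} (a : SubV r n) → decode (encode a) ≡ a
decode-encode (branch i) = refl
decode-encode (inner i j i<j k) with i <ᶠ? j
... | yes i<j′ = cong (λ p → inner i j p k) (<-irrelevant i<j′ i<j)
... | no i≮j   = ⊥-elim (i≮j i<j)

SubV-finite : ∀ r n → Σ ℕ λ N → SubV r n ↔ Fin N
SubV-finite r n = retract-of-Fin⇒finite (toFin ∘ encode) (decode ∘ fromFin)
  λ a → ≡.trans (cong decode (strictlyInverseʳ (encode a))) (decode-encode a)
  where open Inverse (SubCode↔Fin r n) using (strictlyInverseʳ) renaming (to to toFin; from to fromFin)

subst₂-⇔ : {A B : Set} (R : A → B → Set) {x x′ : A} {y y′ : B} →
           x ≡ x′ → y ≡ y′ → R x y ⇔ R x′ y′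
subst₂-⇔ R refl refl = ⇔-id _

¬¬-FiniteGraph : (G : Graph) {N : ℕ} → V G ↔ Fin N → ¬ ¬ FiniteGraph G
¬¬-FiniteGraph G {N} enum = ¬¬-map (λ E? → (N , enum) , decideAdjacency E?) decideEnumerated
  where
  open Inverse enum using (strictlyInverseʳ) renaming (to to position; from to vertex)

  decideEnumerated : ¬ ¬ (∀ i j → Dec (E G (vertex i) (vertex j)))
  decideEnumerated = sequence ¬¬-applicative λ _ → sequence ¬¬-applicative λ _ → ¬¬-excluded-middle
    where open RawMonad ¬¬-Monad renaming (rawApplicative to ¬¬-applicative)

  decideAdjacency : (∀ i j → Dec (E G (vertex i) (vertex j))) → ∀ u w → Dec (E G u w)
  decideAdjacency E? u w =
    Dec.map (subst₂-⇔ (E G) (strictlyInverseʳ u) (strictlyInverseʳ w)) (E? (position u) (position w))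

⋀ : ∀ {m n} → (Fin m → Fm n) → Fm n
⋀ {zero}  _ = ff ⇒ ff
⋀ {suc m} φ = φ fz ∧ ⋀ (φ ∘ fs)

∃* : ∀ {m} → Fm m → Sentence
∃* {zero}  φ = φ
∃* {suc m} φ = ∃* (ex φ)

literal : ∀ {n} {A : Set} → Dec A → Fm n → Fm n
literal (yes _) φ = φ
literal (no _)  φ = φ ⇒ ff

module _ {G : Graph} where

  extend-≗ : ∀ {n} {ρ σ : Fin n → V G} (a : V G) → ρ ≗ σ → extend a ρ ≗ extend a σ
  extend-≗ a ρ≗σ fz     = refl
  extend-≗ a ρ≗σ (fs i) = ρ≗σ i

  Sat-resp-≗ : ∀ {n} (φ : Fm n) {ρ σ : Fin n → V G} → ρ ≗ σ → Sat G ρ φ → Sat G σ φ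
  Sat-resp-≗ ff        ρ≗σ ()
  Sat-resp-≗ (adj i j) ρ≗σ = subst₂ (E G) (ρ≗σ i) (ρ≗σ j)
  Sat-resp-≗ (eq i j)  ρ≗σ = subst₂ _≡_ (ρ≗σ i) (ρ≗σ j)
  Sat-resp-≗ (φ ⇒ ψ)   ρ≗σ s = Sat-resp-≗ ψ ρ≗σ ∘ s ∘ Sat-resp-≗ φ (≡.sym ∘ ρ≗σ)
  Sat-resp-≗ (φ ∧ ψ)   ρ≗σ = Product.map (Sat-resp-≗ φ ρ≗σ) (Sat-resp-≗ ψ ρ≗σ)
  Sat-resp-≗ (φ ∨ ψ)   ρ≗σ = Sum.map (Sat-resp-≗ φ ρ≗σ) (Sat-resp-≗ ψ ρ≗σ)
  Sat-resp-≗ (all φ)   ρ≗σ s a = Sat-resp-≗ φ (extend-≗ a ρ≗σ) (s a)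
  Sat-resp-≗ (ex φ)    ρ≗σ (a , s) = a , Sat-resp-≗ φ (extend-≗ a ρ≗σ) s

  ⋀-intro : ∀ {m n} {φ : Fin m → Fm n} {ρ : Fin n → V G} → (∀ i → Sat G ρ (φ i)) → Sat G ρ (⋀ φ)
  ⋀-intro {zero}  s = id
  ⋀-intro {suc m} s = s fz , ⋀-intro (s ∘ fs)

  ⋀-elim : ∀ {m n} {φ : Fin m → Fm n} {ρ : Fin n → V G} → Sat G ρ (⋀ φ) → ∀ i → Sat G ρ (φ i)
  ⋀-elim (s , _) fz     = s
  ⋀-elim (_ , s) (fs i) = ⋀-elim s i

  ∃*-intro : ∀ {m} {φ : Fm m} (ρ : Fin m → V G) → Sat G ρ φ → G ⊨ ∃* φ
  ∃*-intro {zero}  {φ} ρ s = Sat-resp-≗ φ (λ ()) s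
  ∃*-intro {suc m} {φ} ρ s = ∃*-intro (ρ ∘ fs) (ρ fz , Sat-resp-≗ φ head∷tail s)
    where
    head∷tail : ρ ≗ extend (ρ fz) (ρ ∘ fs)
    head∷tail fz     = refl
    head∷tail (fs i) = refl

  ∃*-elim : ∀ {m} {φ : Fm m} → G ⊨ ∃* φ → Σ (Fin m → V G) λ ρ → Sat G ρ φ
  ∃*-elim {zero}  s = noVars , s
  ∃*-elim {suc m} s with ∃*-elim {m} s
  ... | ρ , (a , s′) = extend a ρ , s′

  Sat-literal : ∀ {n} {A : Set} {φ : Fm n} {ρ : Fin n → V G} (d : Dec A) →
                Sat G ρ (literal d φ) ⇔ (A ⇔ Sat G ρ φ)
  Sat-literal (yes a) = mk⇔ (λ s → mk⇔ (const s) (const a)) (λ A⇔φ → to A⇔φ a)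
  Sat-literal (no ¬a) = mk⇔ (λ ¬s → mk⇔ (⊥-elim ∘ ¬a) (⊥-elim ∘ ¬s)) (λ A⇔φ → ¬a ∘ from A⇔φ)

module Diagram (H : Graph) {N : ℕ} (enum : V H ↔ Fin N) (E? : ∀ u w → Dec (E H u w)) where

  open Inverse enum using (strictlyInverseʳ) renaming (to to position; from to vertex)

  position-injective : Injective _≡_ _≡_ position
  position-injective = Injection.injective (↔⇒↣ enum)

  vertex-injective : Injective _≡_ _≡_ vertex
  vertex-injective = Injection.injective (↔⇒↣ (↔-sym enum))

  entry : Fin N → Fin N → Fm N
  entry i j = literal (i ≟ᶠ j) (eq i j) ∧ literal (E? (vertex i) (vertex j)) (adj i j)

  diagram : Sentence
  diagram = ∃* (⋀ λ i → ⋀ λ j → entry i j)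

  Realises : (G : Graph) → (Fin N → V G) → Set
  Realises G ρ = ∀ i j → (i ≡ j ⇔ ρ i ≡ ρ j) × (E H (vertex i) (vertex j) ⇔ E G (ρ i) (ρ j))

  Sat-entry : {G : Graph} {ρ : Fin N → V G} (i j : Fin N) →
              Sat G ρ (entry i j) ⇔ ((i ≡ j ⇔ ρ i ≡ ρ j) × (E H (vertex i) (vertex j) ⇔ E G (ρ i) (ρ j)))
  Sat-entry {G} i j =
    Sat-literal {G = G} {φ = eq i j} (i ≟ᶠ j) ×-⇔ Sat-literal {G = G} {φ = adj i j} (E? _ _)

  Sat-matrix : {G : Graph} {ρ : Fin N → V G} → Sat G ρ (⋀ λ i → ⋀ λ j → entry i j) ⇔ Realises G ρ
  Sat-matrix = mk⇔
    (λ s i j → to (Sat-entry i j) (⋀-elim (⋀-elim s i) j))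
    (λ R → ⋀-intro λ i → ⋀-intro λ j → from (Sat-entry i j) (R i j))

  realisation⇔inducedSub : {G : Graph} → (Σ (Fin N → V G) (Realises G)) ⇔ InducedSub H G
  realisation⇔inducedSub {G} = mk⇔ induce realise
    where
    induce : Σ (Fin N → V G) (Realises G) → InducedSub H G
    induce (ρ , R) =
      ρ ∘ position ,
      (λ u w → position-injective ∘ from (proj₁ (R (position u) (position w)))) ,
      λ u w → proj₂ (R (position u) (position w))
                ⇔-∘ subst₂-⇔ (E H) (≡.sym (strictlyInverseʳ u)) (≡.sym (strictlyInverseʳ w))

    realise : InducedSub H G → Σ (Fin N → V G) (Realises G)
    realise (f , f-injective , f-adj) =
      f ∘ vertex ,
      λ i j → mk⇔ (cong (f ∘ vertex)) (vertex-injective ∘ f-injective _ _) , f-adj (vertex i) (vertex j)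

  ⊨diagram⇔inducedSub : {G : Graph} → G ⊨ diagram ⇔ InducedSub H G
  ⊨diagram⇔inducedSub {G} = realisation⇔inducedSub {G} ⇔-∘
    mk⇔ (Product.map₂ (to Sat-matrix) ∘ ∃*-elim) (λ (ρ , R) → ∃*-intro ρ (from Sat-matrix R))

elementaryClosure-finiteInducedSub : {C : GraphClass} {M H : Graph} → Hereditary C →
  InElemClosure C M → FiniteGraph H → InducedSub H M → ¬ ¬ C H
elementaryClosure-finiteInducedSub {C} {M} {H} hereditary M∈ finite@((_ , enum) , E?) H⊆M H∉C =
  M∈ (diagram ⇒ ff)
    (λ G G∈C G⊨diagram → H∉C (hereditary G H G∈C finite (to ⊨diagram⇔inducedSub G⊨diagram)))
    (from ⊨diagram⇔inducedSub H⊆M)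
  where open Diagram H enum E?

pullback : (G : Graph) {A : Set} → (A → V G) → Graph
pullback G {A} f = record
  { V      = A
  ; E      = λ a b → E G (f a) (f b)
  ; sym    = λ a b → sym G (f a) (f b)
  ; irrefl = λ a → irrefl G (f a)
  }

pullback-inducedSub : {G : Graph} {A : Set} {f : A → V G} →
                      Injective _≡_ _≡_ f → InducedSub (pullback G f) G
pullback-inducedSub {f = f} f-injective = f , (λ _ _ → f-injective) , λ _ _ → ⇔-id _

pullbackExpansion : ∀ {k} (e : Expansion k) {A : Set} → (A → V (graph e)) → Expansion k
pullbackExpansion e f = record { graph = pullback (graph e) f ; P = λ p a → P e p (f a) }

module _ {k : ℕ} {e : Expansion k} {A : Set} {f : A → V (graph e)} (f-injective : Injective _≡_ _≡_ f) where

  QSat-pullback : (χ : QF k) {ρ : Fin 2 → A} {σ : Fin 2 → V (graph e)} → (∀ i → f (ρ i) ≡ σ i) →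
                  QSatρ (pullbackExpansion e f) ρ χ ⇔ QSatρ e σ χ
  QSat-pullback qff         fρ≗σ = ⇔-id _
  QSat-pullback (qadj i j)  fρ≗σ = subst₂-⇔ (E (graph e)) (fρ≗σ i) (fρ≗σ j)
  QSat-pullback (qeq i j)   fρ≗σ = subst₂-⇔ _≡_ (fρ≗σ i) (fρ≗σ j) ⇔-∘ mk⇔ (cong f) f-injective
  QSat-pullback (qpred p i) fρ≗σ = subst₂-⇔ (λ q x → P e q x) refl (fρ≗σ i)
  QSat-pullback (χ q⇒ ψ)    fρ≗σ = →-cong-⇔ (QSat-pullback χ fρ≗σ) (QSat-pullback ψ fρ≗σ)
  QSat-pullback (χ q∧ ψ)    fρ≗σ = QSat-pullback χ fρ≗σ ×-⇔ QSat-pullback ψ fρ≗σ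
  QSat-pullback (χ q∨ ψ)    fρ≗σ = QSat-pullback χ fρ≗σ ⊎-⇔ QSat-pullback ψ fρ≗σ

  φAdj-pullback : (φ : QF k) (a b : A) → φAdj (pullbackExpansion e f) φ a b ⇔ φAdj e φ (f a) (f b)
  φAdj-pullback φ a b =
    ¬-cong-⇔ (mk⇔ (cong f) f-injective)
      ×-⇔ (QSat-pullback φ (pair-map a b) ⊎-⇔ QSat-pullback φ (pair-map b a))
    where
    pair-map : ∀ x y i → f (pair x y i) ≡ pair (f x) (f y) i
    pair-map x y fz     = refl
    pair-map x y (fs _) = refl

ContainsSub-pullback : ∀ {k r n} {e : Expansion k} {φ : QF k} (copy : ContainsSub r n e φ) →
                       ContainsSub r n (pullbackExpansion e (proj₁ copy)) φ
ContainsSub-pullback {e = e} {φ} (f , f-injective , f-adj) =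
  id , (λ _ _ → id) , λ a b → ⇔-sym (φAdj-pullback {e = e} (f-injective _ _) φ a b) ⇔-∘ f-adj a b

mainTheorem15 : (C : GraphClass) → (∀ G → C G → FiniteGraph G) →
                Hereditary C → PatternFree C →
                (M : Graph) → InElemClosure C M →
                PatternFree (Singleton M)
mainTheorem15 C _ hereditary patternFree M M∈ r 1≤r k Dhat Dhat⊆M φ
  with patternFree r 1≤r k (C ∘ graph) (λ _ → id) φ
... | n , noPattern = n , λ e e∈Dhat → noCopy e (subst (InElemClosure C) (≡.sym (Dhat⊆M e e∈Dhat)) M∈)
  where
  noCopy : ∀ e → InElemClosure C (graph e) → ¬ ContainsSub r n e φ
  noCopy e e∈closure copy@(f , f-injective , _) =
    ¬¬-FiniteGraph H (proj₂ (SubV-finite r n)) λ H-finite →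
    elementaryClosure-finiteInducedSub hereditary e∈closure H-finite H⊆e λ H∈C →
    noPattern (pullbackExpansion e f) H∈C (ContainsSub-pullback {e = e} {φ} copy)
    where
    H : Graph
    H = pullback (graph e) f

    H⊆e : InducedSub H (graph e)
    H⊆e = pullback-inducedSub {graph e} (f-injective _ _)
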